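{- Let $n\ge 3$. Among all polyomino chains with $n$ squares, the linear chain $Li_n$ attains the minimum value of the augmented Zagreb index $AZI$ when $n\ge 6$, while the zigzag chain $Z_n$ attains the minimum $AZI$ when $n\in\{3,4,5\}$.
   Context: Polyomino chains (restricted model). For $n\ge 2$, a polyomino chain with $n$ squares is a sequence of closed unit squares $S_1,\dots,S_n$ in the plane with $S_1=[0,1]\times[0,1]$, $S_2=[1,2]\times[0,1]$, and for $k\ge 3$, $S_k=S_{k-1}+v_k$, where $v_2=(1,0)$ and each $v_k\in\{(1,0),(0,-1)\}$ satisfies $v_k=v_{k-1}$ if $L_k=1$ and $v_k\neq v_{k-1}$ if $L_k=2$. For $n\ge3$ the chain is determined by its link vector $(L_3,\dots,L_n)\in\{1,2\}^{n-2}$ and denoted $PC(L_3,\dots,L_n)$. The linear chain is $Li_n=PC(1,\dots,1)$ and the zigzag chain is $Z_n=PC(2,\dots,2)$. Each chain is regarded as the graph whose vertices are the corners of the squares and whose edges are the sides of the squares. The augmented Zagreb index is $AZI(G)=\sum_{uv\in E(G)}\left(\frac{d_ud_v}{d_u+d_v-2}\right)^3$, where $d_u$ is the degree of $u$. -}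

module Defs where

open import Data.Nat as ℕ using (ℕ; zero; suc; _∸_)
open import Data.Integer as ℤ using (ℤ; +_)
open import Data.Rational as ℚ using (ℚ; _/_)
open import Data.Product using (_×_; _,_; proj₁; proj₂)
open import Data.Product.Properties using (≡-dec)
open import Data.Sum using (_⊎_)
open import Data.List using (List; []; _∷_; _++_; concatMap; filter; deduplicate; length; map; foldr)
open import Data.Vec using (Vec; toList; replicate)
open import Relation.Binary.PropositionalEquality using (_≡_)
open import Relation.Nullary.Decidable using (_⊎-dec_; Dec)

data Link : Set where
  one two : Link

data Dir : Set where
  right down : Dir

flip : Dir → Dir
flip right = down
flip down  = right

Point : Set
Point = ℤ × ℤ

step : Point → Dir → Point
step (x , y) right = (x ℤ.+ + 1 , y)
step (x , y) down  = (x , y ℤ.- + 1)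

-- lower-left corners of S_k, S_{k+1}, … given current corner, previous direction, remaining links
squaresFrom : Point → Dir → List Link → List Point
squaresFrom p d [] = []
squaresFrom p d (one ∷ ls) = let q = step p d in q ∷ squaresFrom q d ls
squaresFrom p d (two ∷ ls) = let q = step p (flip d) in q ∷ squaresFrom q (flip d) ls

-- lower-left corners of S_1, …, S_n for PC(L_3,…,L_n); S_1 = [0,1]², S_2 = [1,2]×[0,1], v_2 = (1,0)
squares : List Link → List Point
squares ls = (+ 0 , + 0) ∷ (+ 1 , + 0) ∷ squaresFrom (+ 1 , + 0) right ls

Edge : Set
Edge = Point × Point

sides : Point → List Edge
sides (x , y) =
  ((x , y) , (x ℤ.+ + 1 , y)) ∷
  ((x , y ℤ.+ + 1) , (x ℤ.+ + 1 , y ℤ.+ + 1)) ∷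
  ((x , y) , (x , y ℤ.+ + 1)) ∷
  ((x ℤ.+ + 1 , y) , (x ℤ.+ + 1 , y ℤ.+ + 1)) ∷ []

_≟P_ : (p q : Point) → Dec (p ≡ q)
_≟P_ = ≡-dec ℤ._≟_ ℤ._≟_

_≟E_ : (e f : Edge) → Dec (e ≡ f)
_≟E_ = ≡-dec _≟P_ _≟P_

-- edge set of the chain graph (sides are given with canonical endpoint order, so duplicates are syntactic)
edges : List Link → List Edge
edges ls = deduplicate _≟E_ (concatMap sides (squares ls))

degree : List Link → Point → ℕ
degree ls v = length (filter (λ e → (v ≟P proj₁ e) ⊎-dec (v ≟P proj₂ e)) (edges ls))

-- (a·b / (a+b-2))^3 ; the zero-denominator case never occurs (all degrees are ≥ 2)
azTerm : ℕ → ℕ → ℚ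
azTerm a b with a ℕ.+ b ∸ 2
... | zero  = ℚ.0ℚ
... | suc k = let r = (+ (a ℕ.* b)) / suc k in r ℚ.* r ℚ.* r

AZI : List Link → ℚ
AZI ls = foldr ℚ._+_ ℚ.0ℚ
  (map (λ e → azTerm (degree ls (proj₁ e)) (degree ls (proj₂ e))) (edges ls))

AZI-PC : (n : ℕ) → Vec Link (n ∸ 2) → ℚ
AZI-PC n L = AZI (toList L)

linear : (n : ℕ) → Vec Link (n ∸ 2)
linear n = replicate (n ∸ 2) one

zigzag : (n : ℕ) → Vec Link (n ∸ 2)
zigzag n = replicate (n ∸ 2) two

-- The AZI is a sum over the edges of a function of the degrees of their endpoints, and appending
-- a square changes degrees only at its four corners.  Along a chain the level x − y grows by one
-- per square, so these corners lie strictly above every side of the squares before the last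
-- three; by translation invariance the increase of the AZI is therefore determined by the last
-- three squares and the new one, i.e. by the last two links.  Computing the eight such windows
-- gives
--   AZI (PC (L₃ , … , Lₙ)) = aziTriple L₃ + Σₖ aziGain Lₖ₋₁ Lₖ .
-- The gain aziGain one one = 2187/64 is the smallest one, and it makes up for the cheaper start
-- of the zigzag chain (aziTriple two < aziTriple one) as soon as three gains follow, i.e. for
-- n ≥ 6; the chains with n ≤ 5 are compared directly.
module Submission where

open import Defs
open import Algebra.Bundles using (AbelianGroup)
open import Level using (Level)
open import Data.Bool using (true; false)
open import Data.Integer as ℤ using (ℤ; 0ℤ; 1ℤ)
import Data.Integer.Properties as ℤ
open import Data.Integer.Tactic.RingSolver using (solve-∀)
open import Data.List as List using (List; []; _∷_; _++_; map; filter; length; foldr; concatMap; deduplicate)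
open import Data.List.Properties
  using (filter-all; filter-none; filter-++; filter-≐; ++-identityʳ; ++-assoc; map-++; map-∘;
         length-map; concatMap-++; concatMap-map; concatMap-cong; map-concatMap)
open import Data.List.Relation.Unary.All as All using (All; []; _∷_; all?)
open import Data.List.Relation.Unary.All.Properties using (all-filter; filter⁺; deduplicate⁺; ++⁺; map⁺)
open import Data.List.Relation.Unary.Any using (here; there)
open import Data.List.Membership.Propositional using (_∈_; _∉_)
open import Data.List.Membership.Propositional.Properties
  using (∈-map⁺; ∈-map⁻; ∈-++⁺ˡ; ∈-++⁺ʳ; ∈-++⁻)
import Data.List.Membership.DecPropositional as DecMembership
open import Data.Nat as ℕ using (ℕ; zero; suc; _≤_; s≤s; _∸_)
open import Data.Product as Product using (_×_; _,_; proj₁; proj₂; swap)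
open import Data.Rational as ℚ using (ℚ; 0ℚ; _+_; _-_; _/_) renaming (_≤_ to _≤ℚ_)
import Data.Rational.Properties as ℚ
open import Data.Rational.Solver using (module +-*-Solver)
open import Data.Sum as Sum using (_⊎_; inj₁; inj₂; [_,_])
open import Data.Vec using (Vec; []; _∷_; toList)
open import Data.Vec.Properties using (toList-replicate; length-toList)
open import Function using (_∘_)
open import Function.Definitions using (Injective)
open import Relation.Binary.Definitions using (DecidableEquality)
open import Relation.Binary.PropositionalEquality
  using (_≡_; _≢_; refl; sym; trans; cong; cong₂; subst; module ≡-Reasoning)
open import Relation.Nullary using (Dec; yes; no; does; ¬_; ¬?)
open import Relation.Nullary.Decidable using (map′; _×-dec_; _⊎-dec_; from-yes)
open import Relation.Unary using (Pred; Decidable; _≐_)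
open import Relation.Unary.Properties using (_∩?_)

open import Algebra.Properties.Group (AbelianGroup.group ℤ.+-0-abelianGroup) using (∙-cancelˡ)

private
  variable
    a b ℓ₁ ℓ₂ : Level
    A : Set a
    B : Set b

filter-filter : {P : Pred A ℓ₁} {Q : Pred A ℓ₂} (P? : Decidable P) (Q? : Decidable Q) →
                ∀ xs → filter P? (filter Q? xs) ≡ filter (Q? ∩? P?) xs
filter-filter P? Q? []       = refl
filter-filter P? Q? (x ∷ xs) with Q? x
... | no _  = filter-filter P? Q? xs
... | yes _ with P? x
...   | yes _ = cong (x ∷_) (filter-filter P? Q? xs)
...   | no _  = filter-filter P? Q? xs

filter-comm : {P : Pred A ℓ₁} {Q : Pred A ℓ₂} (P? : Decidable P) (Q? : Decidable Q) →
              ∀ xs → filter P? (filter Q? xs) ≡ filter Q? (filter P? xs)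
filter-comm P? Q? xs = begin
  filter P? (filter Q? xs)
    ≡⟨ filter-filter P? Q? xs ⟩
  filter (Q? ∩? P?) xs
    ≡⟨ filter-≐ (Q? ∩? P?) (P? ∩? Q?) (swap , swap) xs ⟩
  filter (P? ∩? Q?) xs
    ≡⟨ filter-filter Q? P? xs ⟨
  filter Q? (filter P? xs) ∎
  where open ≡-Reasoning

filter-map : {P : Pred B ℓ₁} (P? : Decidable P) (f : A → B) →
             ∀ xs → filter P? (map f xs) ≡ map f (filter (P? ∘ f) xs)
filter-map P? f []       = refl
filter-map P? f (x ∷ xs) with does (P? (f x))
... | true  = cong (f x ∷_) (filter-map P? f xs)
... | false = filter-map P? f xs

∈-map⁻-injective : {f : A → B} → Injective _≡_ _≡_ f →
                   ∀ {x xs} → f x ∈ map f xs → x ∈ xs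
∈-map⁻-injective f-inj fx∈ with ∈-map⁻ _ fx∈
... | y , y∈ , fx≡fy rewrite f-inj fx≡fy = y∈

module Deduplication (_≟_ : DecidableEquality A) where

  open DecMembership _≟_ using (_∉?_)

  dedup : List A → List A
  dedup = deduplicate _≟_

  _≢?_ : ∀ x → Decidable (x ≢_)
  x ≢? y = ¬? (x ≟ y)

  filter-dedup : {P : Pred A ℓ₁} (P? : Decidable P) → ∀ xs → filter P? (dedup xs) ≡ dedup (filter P? xs)
  filter-dedup P? []       = refl
  filter-dedup P? (x ∷ xs) with P? x
  ... | yes _  = cong (x ∷_) (begin
    filter P? (filter (x ≢?_) (dedup xs))
      ≡⟨ filter-comm P? (x ≢?_) (dedup xs) ⟩
    filter (x ≢?_) (filter P? (dedup xs))
      ≡⟨ cong (filter (x ≢?_)) (filter-dedup P? xs) ⟩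
    filter (x ≢?_) (dedup (filter P? xs)) ∎)
    where open ≡-Reasoning
  ... | no ¬px = begin
    filter P? (filter (x ≢?_) (dedup xs))
      ≡⟨ filter-comm P? (x ≢?_) (dedup xs) ⟩
    filter (x ≢?_) (filter P? (dedup xs))
      ≡⟨ filter-all (x ≢?_) (All.map (λ { py refl → ¬px py }) (all-filter P? (dedup xs))) ⟩
    filter P? (dedup xs)
      ≡⟨ filter-dedup P? xs ⟩
    dedup (filter P? xs) ∎
    where open ≡-Reasoning

  dedup-++ : ∀ xs ys → dedup (xs ++ ys) ≡ dedup xs ++ dedup (filter (_∉? xs) ys)
  dedup-++ []       ys = cong dedup (sym (filter-all (_∉? []) (All.tabulate λ _ ())))
  dedup-++ (x ∷ xs) ys = cong (x ∷_) (begin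
    filter (x ≢?_) (dedup (xs ++ ys))
      ≡⟨ cong (filter (x ≢?_)) (dedup-++ xs ys) ⟩
    filter (x ≢?_) (dedup xs ++ dedup ys∉xs)
      ≡⟨ filter-++ (x ≢?_) (dedup xs) (dedup ys∉xs) ⟩
    filter (x ≢?_) (dedup xs) ++ filter (x ≢?_) (dedup ys∉xs)
      ≡⟨ cong (filter (x ≢?_) (dedup xs) ++_) new-after-x ⟩
    filter (x ≢?_) (dedup xs) ++ dedup (filter (_∉? (x ∷ xs)) ys) ∎)
    where
    open ≡-Reasoning
    ys∉xs = filter (_∉? xs) ys
    ∉-∷ : (λ y → y ∉ xs × x ≢ y) ≐ (_∉ x ∷ xs)
    ∉-∷ = (λ { (_ , x≢y) (here refl) → x≢y refl ; (y∉xs , _) (there y∈xs) → y∉xs y∈xs })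
        , (λ y∉ → y∉ ∘ there , λ { refl → y∉ (here refl) })
    new-after-x : filter (x ≢?_) (dedup ys∉xs) ≡ dedup (filter (_∉? (x ∷ xs)) ys)
    new-after-x = begin
      filter (x ≢?_) (dedup ys∉xs)
        ≡⟨ filter-dedup (x ≢?_) ys∉xs ⟩
      dedup (filter (x ≢?_) ys∉xs)
        ≡⟨ cong dedup (filter-filter (x ≢?_) (_∉? xs) ys) ⟩
      dedup (filter ((_∉? xs) ∩? (x ≢?_)) ys)
        ≡⟨ cong dedup (filter-≐ _ (_∉? (x ∷ xs)) ∉-∷ ys) ⟩
      dedup (filter (_∉? (x ∷ xs)) ys) ∎

  dedup-map : ∀ {f : A → A} → Injective _≡_ _≡_ f → ∀ xs → dedup (map f xs) ≡ map f (dedup xs)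
  dedup-map         f-inj []       = refl
  dedup-map {f = f} f-inj (x ∷ xs) = cong (f x ∷_) (begin
    filter (f x ≢?_) (dedup (map f xs))
      ≡⟨ cong (filter (f x ≢?_)) (dedup-map f-inj xs) ⟩
    filter (f x ≢?_) (map f (dedup xs))
      ≡⟨ filter-map (f x ≢?_) f (dedup xs) ⟩
    map f (filter ((f x ≢?_) ∘ f) (dedup xs))
      ≡⟨ cong (map f) (filter-≐ _ (x ≢?_) (_∘ cong f , _∘ f-inj) (dedup xs)) ⟩
    map f (filter (x ≢?_) (dedup xs)) ∎)
    where open ≡-Reasoning

open Deduplication _≟E_ using (dedup; filter-dedup; dedup-++; dedup-map)
open DecMembership _≟E_ using (_∉?_)
open DecMembership _≟P_ using (_∈?_)

∑ : List A → (A → ℚ) → ℚ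
∑ xs f = foldr _+_ 0ℚ (map f xs)

∑-++ : ∀ xs ys (f : A → ℚ) → ∑ (xs ++ ys) f ≡ ∑ xs f + ∑ ys f
∑-++ []       ys f = sym (ℚ.+-identityˡ (∑ ys f))
∑-++ (x ∷ xs) ys f = trans (cong (f x +_) (∑-++ xs ys f)) (sym (ℚ.+-assoc (f x) (∑ xs f) (∑ ys f)))

∑-cong : ∀ {xs} {f g : A → ℚ} → All (λ x → f x ≡ g x) xs → ∑ xs f ≡ ∑ xs g
∑-cong []            = refl
∑-cong (fx≡gx ∷ eqs) = cong₂ _+_ fx≡gx (∑-cong eqs)

∑-map : (g : A → B) → ∀ xs (f : B → ℚ) → ∑ (map g xs) f ≡ ∑ xs (f ∘ g)
∑-map g xs f = cong (foldr _+_ 0ℚ) (sym (map-∘ xs))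

∑-partition : {P : Pred A ℓ₁} (P? : Decidable P) → ∀ xs (f : A → ℚ) →
              ∑ xs f ≡ ∑ (filter P? xs) f + ∑ (filter (¬? ∘ P?) xs) f
∑-partition P? []       f = refl
∑-partition P? (x ∷ xs) f with does (P? x)
... | true  = trans (cong (f x +_) (∑-partition P? xs f)) (sym (ℚ.+-assoc (f x) _ _))
... | false = trans (cong (f x +_) (∑-partition P? xs f)) (x+[y+z]≡y+[x+z] (f x) (∑ (filter P? xs) f) _)
  where
  x+[y+z]≡y+[x+z] : ∀ x y z → x + (y + z) ≡ y + (x + z)
  x+[y+z]≡y+[x+z] = solve 3 (λ x y z → x :+ (y :+ z) := y :+ (x :+ z)) refl
    where open +-*-Solver

∀-Dir? : {P : Dir → Set ℓ₁} → Decidable P → Dec (∀ d → P d)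
∀-Dir? P? = map′ (λ { (p , q) right → p ; (p , q) down → q }) (λ f → f right , f down)
                 (P? right ×-dec P? down)

∀-Link? : {P : Link → Set ℓ₁} → Decidable P → Dec (∀ l → P l)
∀-Link? P? = map′ (λ { (p , q) one → p ; (p , q) two → q }) (λ f → f one , f two)
                  (P? one ×-dec P? two)

∀-Vec? : ∀ m {P : Vec Link m → Set ℓ₁} → Decidable P → Dec (∀ ls → P ls)
∀-Vec? zero    P? = map′ (λ { p [] → p }) (λ f → f []) (P? [])
∀-Vec? (suc m) P? = map′ (λ { f (l ∷ ls) → f l ls }) (λ f l ls → f (l ∷ ls))
                         (∀-Link? λ l → ∀-Vec? m λ ls → P? (l ∷ ls))

allSides : List Point → List Edge
allSides = concatMap sides

Incident : Point → Edge → Set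
Incident v e = v ≡ proj₁ e ⊎ v ≡ proj₂ e

incident? : ∀ v → Decidable (Incident v)
incident? v e = (v ≟P proj₁ e) ⊎-dec (v ≟P proj₂ e)

deg : List Edge → Point → ℕ
deg W v = length (filter (incident? v) (dedup W))

weight : List Edge → Edge → ℚ
weight W e = azTerm (deg W (proj₁ e)) (deg W (proj₂ e))

-- Opaque, so that unifying `azi ?W` with `azi W` never evaluates the AZI of a concrete W.
opaque
  azi : List Edge → ℚ
  azi W = ∑ (dedup W) (weight W)

deg-filter : ∀ W v → deg W v ≡ length (dedup (filter (incident? v) W))
deg-filter W v = cong length (filter-dedup (incident? v) W)

module _ {v : Point} {X : List Edge} (X-avoids-v : All (¬_ ∘ Incident v) X) where

  deg-++-nonincidentˡ : ∀ W → deg (X ++ W) v ≡ deg W v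
  deg-++-nonincidentˡ W = begin
    deg (X ++ W) v
      ≡⟨ deg-filter (X ++ W) v ⟩
    length (dedup (filter (incident? v) (X ++ W)))
      ≡⟨ cong (length ∘ dedup) (filter-++ (incident? v) X W) ⟩
    length (dedup (filter (incident? v) X ++ Wᵥ))
      ≡⟨ cong (λ Y → length (dedup (Y ++ Wᵥ))) (filter-none (incident? v) X-avoids-v) ⟩
    length (dedup Wᵥ)
      ≡⟨ deg-filter W v ⟨
    deg W v ∎
    where
    open ≡-Reasoning
    Wᵥ = filter (incident? v) W

  deg-++-nonincidentʳ : ∀ W → deg (W ++ X) v ≡ deg W v
  deg-++-nonincidentʳ W = begin
    deg (W ++ X) v
      ≡⟨ deg-filter (W ++ X) v ⟩
    length (dedup (filter (incident? v) (W ++ X)))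
      ≡⟨ cong (length ∘ dedup) (filter-++ (incident? v) W X) ⟩
    length (dedup (Wᵥ ++ filter (incident? v) X))
      ≡⟨ cong (λ Y → length (dedup (Wᵥ ++ Y))) (filter-none (incident? v) X-avoids-v) ⟩
    length (dedup (Wᵥ ++ []))
      ≡⟨ cong (length ∘ dedup) (++-identityʳ Wᵥ) ⟩
    length (dedup Wᵥ)
      ≡⟨ deg-filter W v ⟨
    deg W v ∎
    where
    open ≡-Reasoning
    Wᵥ = filter (incident? v) W

Both : (Point → Set) → Edge → Set
Both P e = P (proj₁ e) × P (proj₂ e)

Meets : List Point → Edge → Set
Meets C e = proj₁ e ∈ C ⊎ proj₂ e ∈ C

meets? : ∀ C → Decidable (Meets C)
meets? C e = (proj₁ e ∈? C) ⊎-dec (proj₂ e ∈? C)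

edgesMeeting : List Point → List Edge → List Edge
edgesMeeting C W = filter (meets? C) (dedup W)

newEdges : List Edge → List Edge → List Edge
newEdges W X = dedup (filter (_∉? W) X)

gain : List Point → List Edge → List Edge → ℚ
gain C W X = (∑ (edgesMeeting C W) (weight (W ++ X)) + ∑ (newEdges W X) (weight (W ++ X)))
           - ∑ (edgesMeeting C W) (weight W)

opaque
  unfolding azi

  azi-++ : ∀ C W X → All (Both (_∈ C)) X → azi (W ++ X) ≡ azi W + gain C W X
  azi-++ C W X X-within-C = begin
    azi (W ++ X)
      ≡⟨ cong (λ Y → ∑ Y (weight (W ++ X))) (dedup-++ W X) ⟩
    ∑ (dedup W ++ newEdges W X) (weight (W ++ X))
      ≡⟨ ∑-++ (dedup W) (newEdges W X) (weight (W ++ X)) ⟩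
    ∑ (dedup W) (weight (W ++ X)) + new
      ≡⟨ cong (_+ new) (∑-partition (meets? C) (dedup W) (weight (W ++ X))) ⟩
    (near + ∑ far (weight (W ++ X))) + new
      ≡⟨ cong (λ s → (near + s) + new) (∑-cong (All.map weight-far (all-filter _ (dedup W)))) ⟩
    (near + ∑ far (weight W)) + new
      ≡⟨ regroup near (∑ far (weight W)) new near₀ ⟩
    (near₀ + ∑ far (weight W)) + gain C W X
      ≡⟨ cong (_+ gain C W X) (∑-partition (meets? C) (dedup W) (weight W)) ⟨
    azi W + gain C W X ∎
    where
    open ≡-Reasoning
    far : List Edge
    far = filter (¬? ∘ meets? C) (dedup W)
    near near₀ new : ℚ
    near  = ∑ (edgesMeeting C W) (weight (W ++ X))
    near₀ = ∑ (edgesMeeting C W) (weight W)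
    new   = ∑ (newEdges W X) (weight (W ++ X))
    avoids : ∀ {v} → v ∉ C → All (¬_ ∘ Incident v) X
    avoids v∉C = All.map (λ { (p∈C , _) (inj₁ refl) → v∉C p∈C
                            ; (_ , q∈C) (inj₂ refl) → v∉C q∈C })
                         X-within-C
    weight-far : ∀ {e} → ¬ Meets C e → weight (W ++ X) e ≡ weight W e
    weight-far ¬meets = cong₂ azTerm (deg-++-nonincidentʳ (avoids (¬meets ∘ inj₁)) W)
                                     (deg-++-nonincidentʳ (avoids (¬meets ∘ inj₂)) W)
    regroup : ∀ a f n a₀ → (a + f) + n ≡ (a₀ + f) + ((a + n) - a₀)
    regroup = solve 4 (λ a f n a₀ → (a :+ f) :+ n := (a₀ :+ f) :+ ((a :+ n) :- a₀)) refl
      where open +-*-Solver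

-- Translations

origin : Point
origin = (ℤ.+ 0 , ℤ.+ 0)

shift : Point → Point → Point
shift (a , b) (x , y) = (a ℤ.+ x , b ℤ.+ y)

shiftᴱ : Point → Edge → Edge
shiftᴱ p = Product.map (shift p) (shift p)

shift-origin : ∀ p → shift p origin ≡ p
shift-origin (a , b) = cong₂ _,_ (ℤ.+-identityʳ a) (ℤ.+-identityʳ b)

shift-injective : ∀ p → Injective _≡_ _≡_ (shift p)
shift-injective (a , b) eq = cong₂ _,_ (∙-cancelˡ a _ _ (cong proj₁ eq)) (∙-cancelˡ b _ _ (cong proj₂ eq))

shiftᴱ-injective : ∀ p → Injective _≡_ _≡_ (shiftᴱ p)
shiftᴱ-injective p eq = cong₂ _,_ (shift-injective p (cong proj₁ eq)) (shift-injective p (cong proj₂ eq))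

step-shift : ∀ p u d → step (shift p u) d ≡ shift p (step u d)
step-shift (a , b) (x , y) right = cong (_, b ℤ.+ y) (ℤ.+-assoc a x 1ℤ)
step-shift (a , b) (x , y) down  = cong (a ℤ.+ x ,_) (ℤ.+-assoc b y (ℤ.- 1ℤ))

sides-shift : ∀ p u → sides (shift p u) ≡ map (shiftᴱ p) (sides u)
sides-shift (a , b) (x , y) rewrite ℤ.+-assoc a x 1ℤ | ℤ.+-assoc b y 1ℤ = refl

allSides-shift : ∀ p us → allSides (map (shift p) us) ≡ map (shiftᴱ p) (allSides us)
allSides-shift p us = begin
  concatMap sides (map (shift p) us)
    ≡⟨ concatMap-map sides (shift p) us ⟩
  concatMap (sides ∘ shift p) us
    ≡⟨ concatMap-cong (sides-shift p) us ⟩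
  concatMap (map (shiftᴱ p) ∘ sides) us
    ≡⟨ map-concatMap (shiftᴱ p) sides us ⟨
  map (shiftᴱ p) (concatMap sides us) ∎
  where open ≡-Reasoning

deg-shift : ∀ p W u → deg (map (shiftᴱ p) W) (shift p u) ≡ deg W u
deg-shift p W u = begin
  deg (map (shiftᴱ p) W) (shift p u)
    ≡⟨ deg-filter (map (shiftᴱ p) W) (shift p u) ⟩
  length (dedup (filter (incident? (shift p u)) (map (shiftᴱ p) W)))
    ≡⟨ cong (length ∘ dedup) (filter-map (incident? (shift p u)) (shiftᴱ p) W) ⟩
  length (dedup (map (shiftᴱ p) (filter (incident? (shift p u) ∘ shiftᴱ p) W)))
    ≡⟨ cong (length ∘ dedup ∘ map (shiftᴱ p)) (filter-≐ _ (incident? u) incident-shift W) ⟩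
  length (dedup (map (shiftᴱ p) Wᵤ))
    ≡⟨ cong length (dedup-map (shiftᴱ-injective p) Wᵤ) ⟩
  length (map (shiftᴱ p) (dedup Wᵤ))
    ≡⟨ length-map (shiftᴱ p) (dedup Wᵤ) ⟩
  length (dedup Wᵤ)
    ≡⟨ deg-filter W u ⟨
  deg W u ∎
  where
  open ≡-Reasoning
  Wᵤ = filter (incident? u) W
  incident-shift : (Incident (shift p u) ∘ shiftᴱ p) ≐ Incident u
  incident-shift = Sum.map (shift-injective p) (shift-injective p) , Sum.map (cong (shift p)) (cong (shift p))

path : Point → List Dir → List Point
path p []       = p ∷ []
path p (d ∷ ds) = p ∷ path (step p d) ds

path-shift : ∀ p u ds → path (shift p u) ds ≡ map (shift p) (path u ds)
path-shift p u []       = refl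
path-shift p u (d ∷ ds) = cong (shift p u ∷_)
  (trans (cong (λ q → path q ds) (step-shift p u d)) (path-shift p (step u d) ds))

allSides-path : ∀ p ds → allSides (path p ds) ≡ map (shiftᴱ p) (allSides (path origin ds))
allSides-path p ds = begin
  allSides (path p ds)
    ≡⟨ cong (λ q → allSides (path q ds)) (shift-origin p) ⟨
  allSides (path (shift p origin) ds)
    ≡⟨ cong allSides (path-shift p origin ds) ⟩
  allSides (map (shift p) (path origin ds))
    ≡⟨ allSides-shift p (path origin ds) ⟩
  map (shiftᴱ p) (allSides (path origin ds)) ∎
  where open ≡-Reasoning

-- Levels and the locality of the gain

level : Point → ℤ
level (x , y) = x ℤ.- y

level-shift : ∀ p u → level (shift p u) ≡ level p ℤ.+ level u
level-shift (a , b) (x , y) = [a+x]-[b+y]≡[a-b]+[x-y] a b x y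
  where
  [a+x]-[b+y]≡[a-b]+[x-y] : ∀ a b x y → (a ℤ.+ x) ℤ.- (b ℤ.+ y) ≡ (a ℤ.- b) ℤ.+ (x ℤ.- y)
  [a+x]-[b+y]≡[a-b]+[x-y] = solve-∀

level-step : ∀ p d → level (step p d) ≡ level p ℤ.+ 1ℤ
level-step (x , y) right = [x+1]-y≡[x-y]+1 x y
  where
  [x+1]-y≡[x-y]+1 : ∀ x y → (x ℤ.+ 1ℤ) ℤ.- y ≡ (x ℤ.- y) ℤ.+ 1ℤ
  [x+1]-y≡[x-y]+1 = solve-∀
level-step (x , y) down  = x-[y-1]≡[x-y]+1 x y
  where
  x-[y-1]≡[x-y]+1 : ∀ x y → x ℤ.- (y ℤ.- 1ℤ) ≡ (x ℤ.- y) ℤ.+ 1ℤ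
  x-[y-1]≡[x-y]+1 = solve-∀

Forward : Point → Set
Forward u = 0ℤ ℤ.< level u

forward? : Decidable Forward
forward? u = 0ℤ ℤ.<? level u

Below : ℤ → List Edge → Set
Below d = All (Both (λ u → level u ℤ.≤ d))

Local : List Point → List Edge → List Edge → Set
Local C W X = All Forward C × All (Both Forward) (edgesMeeting C W) × All (Both Forward) X

local? : ∀ C W X → Dec (Local C W X)
local? C W X = all? forward? C ×-dec all? both-forward? (edgesMeeting C W) ×-dec all? both-forward? X
  where both-forward? = λ e → forward? (proj₁ e) ×-dec forward? (proj₂ e)

module Translated (P : List Edge) (b : Point) (P-below : Below (level b) P) where

  private
    sh  = shift b
    shᴱ = shiftᴱ b

  shift-forward-≰ : ∀ {u} → Forward u → level (sh u) ℤ.≰ level b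
  shift-forward-≰ {u} 0<u = ℤ.<⇒≱ (begin-strict
    level b
      ≡⟨ ℤ.+-identityʳ (level b) ⟨
    level b ℤ.+ 0ℤ
      <⟨ ℤ.+-monoʳ-< (level b) 0<u ⟩
    level b ℤ.+ level u
      ≡⟨ level-shift b u ⟨
    level (sh u) ∎)
    where open ℤ.≤-Reasoning

  P-avoids : ∀ {u} → Forward u → All (¬_ ∘ Incident (sh u)) P
  P-avoids fu = All.map (λ { (l₁ , _) (inj₁ refl) → shift-forward-≰ fu l₁
                           ; (_ , l₂) (inj₂ refl) → shift-forward-≰ fu l₂ })
                        P-below

  deg-local : ∀ {u} → Forward u → ∀ V → deg (P ++ map shᴱ V) (sh u) ≡ deg V u
  deg-local {u} fu V = trans (deg-++-nonincidentˡ (P-avoids fu) (map shᴱ V)) (deg-shift b V u)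

  ∑-weight-local : ∀ {Y} → All (Both Forward) Y → ∀ V →
                   ∑ (map shᴱ Y) (weight (P ++ map shᴱ V)) ≡ ∑ Y (weight V)
  ∑-weight-local {Y} Y-fwd V = trans (∑-map shᴱ Y (weight (P ++ map shᴱ V)))
    (∑-cong (All.map (λ (f₁ , f₂) → cong₂ azTerm (deg-local f₁ V) (deg-local f₂ V)) Y-fwd))

  edgesMeeting-local : ∀ {C} → All Forward C → ∀ W →
                       edgesMeeting (map sh C) (P ++ map shᴱ W) ≡ map shᴱ (edgesMeeting C W)
  edgesMeeting-local {C} C-fwd W = begin
    filter (meets? C′) (dedup (P ++ map shᴱ W))
      ≡⟨ filter-dedup (meets? C′) (P ++ map shᴱ W) ⟩
    dedup (filter (meets? C′) (P ++ map shᴱ W))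
      ≡⟨ cong dedup (filter-++ (meets? C′) P (map shᴱ W)) ⟩
    dedup (filter (meets? C′) P ++ filter (meets? C′) (map shᴱ W))
      ≡⟨ cong (λ Y → dedup (Y ++ filter (meets? C′) (map shᴱ W)))
              (filter-none (meets? C′) P-misses-C′) ⟩
    dedup (filter (meets? C′) (map shᴱ W))
      ≡⟨ cong dedup (filter-map (meets? C′) shᴱ W) ⟩
    dedup (map shᴱ (filter (meets? C′ ∘ shᴱ) W))
      ≡⟨ cong (dedup ∘ map shᴱ) (filter-≐ _ (meets? C) meets-shift W) ⟩
    dedup (map shᴱ (filter (meets? C) W))
      ≡⟨ dedup-map (shiftᴱ-injective b) (filter (meets? C) W) ⟩
    map shᴱ (dedup (filter (meets? C) W))
      ≡⟨ cong (map shᴱ) (filter-dedup (meets? C) W) ⟨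
    map shᴱ (edgesMeeting C W) ∎
    where
    open ≡-Reasoning
    C′ = map sh C
    below-∉ : ∀ {v} → level v ℤ.≤ level b → v ∉ C′
    below-∉ v≤b v∈C′ with ∈-map⁻ sh v∈C′
    ... | c , c∈C , refl = shift-forward-≰ (All.lookup C-fwd c∈C) v≤b
    P-misses-C′ : All (¬_ ∘ Meets C′) P
    P-misses-C′ = All.map (λ (l₁ , l₂) → [ below-∉ l₁ , below-∉ l₂ ]) P-below
    meets-shift : (Meets C′ ∘ shᴱ) ≐ Meets C
    meets-shift = Sum.map (∈-map⁻-injective (shift-injective b)) (∈-map⁻-injective (shift-injective b))
                , Sum.map (∈-map⁺ sh) (∈-map⁺ sh)

  newEdges-local : ∀ {X} → All (Both Forward) X → ∀ W →
                   newEdges (P ++ map shᴱ W) (map shᴱ X) ≡ map shᴱ (newEdges W X)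
  newEdges-local {X} X-fwd W = begin
    dedup (filter (_∉? P ++ W′) (map shᴱ X))
      ≡⟨ cong dedup (filter-≐ _ ((_∉? P) ∩? (_∉? W′)) ∉-++ (map shᴱ X)) ⟩
    dedup (filter ((_∉? P) ∩? (_∉? W′)) (map shᴱ X))
      ≡⟨ cong dedup (filter-filter (_∉? W′) (_∉? P) (map shᴱ X)) ⟨
    dedup (filter (_∉? W′) (filter (_∉? P) (map shᴱ X)))
      ≡⟨ cong (dedup ∘ filter (_∉? W′)) (filter-all (_∉? P) X-misses-P) ⟩
    dedup (filter (_∉? W′) (map shᴱ X))
      ≡⟨ cong dedup (filter-map (_∉? W′) shᴱ X) ⟩
    dedup (map shᴱ (filter ((_∉? W′) ∘ shᴱ) X))
      ≡⟨ cong (dedup ∘ map shᴱ) (filter-≐ _ (_∉? W) ∉-shift X) ⟩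
    dedup (map shᴱ (filter (_∉? W) X))
      ≡⟨ dedup-map (shiftᴱ-injective b) (filter (_∉? W) X) ⟩
    map shᴱ (newEdges W X) ∎
    where
    open ≡-Reasoning
    W′ = map shᴱ W
    ∉-++ : (_∉ P ++ W′) ≐ (λ e → e ∉ P × e ∉ W′)
    ∉-++ = (λ e∉ → e∉ ∘ ∈-++⁺ˡ , e∉ ∘ ∈-++⁺ʳ P)
         , (λ (∉P , ∉W′) e∈ → [ ∉P , ∉W′ ] (∈-++⁻ P e∈))
    X-misses-P : All (_∉ P) (map shᴱ X)
    X-misses-P = map⁺ (All.map (λ (f₁ , _) e∈P → shift-forward-≰ f₁ (proj₁ (All.lookup P-below e∈P)))
                               X-fwd)
    ∉-shift : ((_∉ W′) ∘ shᴱ) ≐ (_∉ W)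
    ∉-shift = (λ ∉W′ e∈W → ∉W′ (∈-map⁺ shᴱ e∈W))
            , (λ ∉W e∈W′ → ∉W (∈-map⁻-injective (shiftᴱ-injective b) e∈W′))

  gain-local : ∀ {C W X} → Local C W X → gain (map sh C) (P ++ map shᴱ W) (map shᴱ X) ≡ gain C W X
  gain-local {C} {W} {X} (C-fwd , M-fwd , X-fwd) = begin
    gain (map sh C) W′ (map shᴱ X)
      ≡⟨ cong₂ (λ M′ N′ → g M′ N′ (W′ ++ map shᴱ X))
               (edgesMeeting-local C-fwd W) (newEdges-local X-fwd W) ⟩
    g (map shᴱ M) (map shᴱ N) (W′ ++ map shᴱ X)
      ≡⟨ cong (g (map shᴱ M) (map shᴱ N)) (trans (++-assoc P (map shᴱ W) (map shᴱ X))
                                                  (cong (P ++_) (sym (map-++ shᴱ W X)))) ⟩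
    g (map shᴱ M) (map shᴱ N) (P ++ map shᴱ (W ++ X))
      ≡⟨ cong₂ _-_ (cong₂ _+_ (∑-weight-local M-fwd (W ++ X)) (∑-weight-local N-fwd (W ++ X)))
                   (∑-weight-local M-fwd W) ⟩
    gain C W X ∎
    where
    open ≡-Reasoning
    M  = edgesMeeting C W
    N  = newEdges W X
    W′ = P ++ map shᴱ W
    g : List Edge → List Edge → List Edge → ℚ
    g M′ N′ V = (∑ M′ (weight V) + ∑ N′ (weight V)) - ∑ M′ (weight W′)
    N-fwd : All (Both Forward) N
    N-fwd = deduplicate⁺ _≟E_ (filter⁺ (_∉? W) X-fwd)

-- Windows of three squares

corners : Point → List Point
corners (x , y) = (x , y) ∷ (x ℤ.+ 1ℤ , y) ∷ (x , y ℤ.+ 1ℤ) ∷ (x ℤ.+ 1ℤ , y ℤ.+ 1ℤ) ∷ []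

sides-corners : ∀ p → All (Both (_∈ corners p)) (sides p)
sides-corners (x , y) = (c₀ , c₁) ∷ (c₂ , c₃) ∷ (c₀ , c₂) ∷ (c₁ , c₃) ∷ []
  where
  c₀ = here refl
  c₁ = there (here refl)
  c₂ = there (there (here refl))
  c₃ = there (there (there (here refl)))

window : Dir → Dir → List Point
window t₁ t₂ = path origin (t₁ ∷ t₂ ∷ [])

extension : Dir → Dir → Dir → Point
extension t₁ t₂ t₃ = step (step (step origin t₁) t₂) t₃

windowGain : Dir → Dir → Dir → ℚ
windowGain t₁ t₂ t₃ = gain (corners q) (allSides (window t₁ t₂)) (allSides (q ∷ []))
  where q = extension t₁ t₂ t₃

window-local : ∀ t₁ t₂ t₃ → let q = extension t₁ t₂ t₃ in
               Local (corners q) (allSides (window t₁ t₂)) (allSides (q ∷ []))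
window-local = from-yes (∀-Dir? λ t₁ → ∀-Dir? λ t₂ → ∀-Dir? λ t₃ →
  let q = extension t₁ t₂ t₃ in local? (corners q) (allSides (window t₁ t₂)) (allSides (q ∷ [])))

azi-extend : ∀ P b t₁ t₂ t₃ → Below (level b) P →
             azi (P ++ allSides (path b (t₁ ∷ t₂ ∷ t₃ ∷ [])))
               ≡ azi (P ++ allSides (path b (t₁ ∷ t₂ ∷ []))) + windowGain t₁ t₂ t₃
azi-extend P b t₁ t₂ t₃ P-below = begin
  azi (P ++ allSides (path b (t₁ ∷ t₂ ∷ t₃ ∷ [])))
    ≡⟨ cong (λ W → azi (P ++ W)) (allSides-path b (t₁ ∷ t₂ ∷ t₃ ∷ [])) ⟩
  azi (P ++ map shᴱ (allSides (window t₁ t₂ ++ q ∷ [])))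
    ≡⟨ cong (λ W → azi (P ++ map shᴱ W)) (concatMap-++ sides (window t₁ t₂) (q ∷ [])) ⟩
  azi (P ++ map shᴱ (W₀ ++ X₀))
    ≡⟨ cong azi (trans (cong (P ++_) (map-++ shᴱ W₀ X₀))
                       (sym (++-assoc P (map shᴱ W₀) (map shᴱ X₀)))) ⟩
  azi ((P ++ map shᴱ W₀) ++ map shᴱ X₀)
    ≡⟨ azi-++ (map (shift b) (corners q)) (P ++ map shᴱ W₀) (map shᴱ X₀) X₀-within ⟩
  azi (P ++ map shᴱ W₀) + gain (map (shift b) (corners q)) (P ++ map shᴱ W₀) (map shᴱ X₀)
    ≡⟨ cong₂ _+_ (cong (λ W → azi (P ++ W)) (sym (allSides-path b (t₁ ∷ t₂ ∷ []))))
                 (Translated.gain-local P b P-below (window-local t₁ t₂ t₃)) ⟩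
  azi (P ++ allSides (path b (t₁ ∷ t₂ ∷ []))) + windowGain t₁ t₂ t₃ ∎
  where
  open ≡-Reasoning
  shᴱ = shiftᴱ b
  q   = extension t₁ t₂ t₃
  W₀  = allSides (window t₁ t₂)
  X₀  = allSides (q ∷ [])
  X₀-within : All (Both (_∈ map (shift b) (corners q))) (map shᴱ X₀)
  X₀-within = map⁺ (All.map (Product.map (∈-map⁺ (shift b)) (∈-map⁺ (shift b)))
                            (++⁺ (sides-corners q) []))

-- The AZI of a chain

sides-below : ∀ p → Below (level p ℤ.+ 1ℤ) (sides p)
sides-below p = subst (Below (level p ℤ.+ 1ℤ)) sides-p
  (map⁺ {f = shiftᴱ p} (All.map (λ {e} (l₁ , l₂) → bound (proj₁ e) l₁ , bound (proj₂ e) l₂)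
                                origin-sides-below))
  where
  sides-p : map (shiftᴱ p) (sides origin) ≡ sides p
  sides-p = trans (sym (sides-shift p origin)) (cong sides (shift-origin p))
  origin-sides-below : Below 1ℤ (sides origin)
  origin-sides-below = from-yes (all? (λ e → (level (proj₁ e) ℤ.≤? 1ℤ) ×-dec (level (proj₂ e) ℤ.≤? 1ℤ))
                                     (sides origin))
  bound : ∀ u → level u ℤ.≤ 1ℤ → level (shift p u) ℤ.≤ level p ℤ.+ 1ℤ
  bound u u≤1 = subst (ℤ._≤ level p ℤ.+ 1ℤ) (sym (level-shift p u)) (ℤ.+-monoʳ-≤ (level p) u≤1)

Below-step : ∀ {b P} d → Below (level b) P → Below (level (step b d)) (P ++ sides b)
Below-step {b} {P} d P-below = subst (λ l → Below l (P ++ sides b)) (sym (level-step b d))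
  (++⁺ (All.map (Product.map weaken weaken) P-below) (sides-below b))
  where
  weaken : ∀ {i} → i ℤ.≤ level b → i ℤ.≤ level b ℤ.+ 1ℤ
  weaken i≤b = ℤ.≤-trans i≤b (ℤ.i≤i+j (level b) 1ℤ)

pathGains : Dir → Dir → List Dir → ℚ
pathGains t₁ t₂ []        = 0ℚ
pathGains t₁ t₂ (t₃ ∷ ts) = windowGain t₁ t₂ t₃ + pathGains t₂ t₃ ts

azi-path : ∀ P b t₁ t₂ ts → Below (level b) P →
           azi (P ++ allSides (path b (t₁ ∷ t₂ ∷ ts)))
             ≡ azi (P ++ allSides (path b (t₁ ∷ t₂ ∷ []))) + pathGains t₁ t₂ ts
azi-path P b t₁ t₂ []        _       =
  sym (ℚ.+-identityʳ (azi (P ++ allSides (path b (t₁ ∷ t₂ ∷ [])))))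
azi-path P b t₁ t₂ (t₃ ∷ ts) P-below = begin
  azi (P ++ sides b ++ allSides (path b₁ (t₂ ∷ t₃ ∷ ts)))
    ≡⟨ cong azi (++-assoc P (sides b) _) ⟨
  azi ((P ++ sides b) ++ allSides (path b₁ (t₂ ∷ t₃ ∷ ts)))
    ≡⟨ azi-path (P ++ sides b) b₁ t₂ t₃ ts (Below-step t₁ P-below) ⟩
  azi ((P ++ sides b) ++ allSides (path b₁ (t₂ ∷ t₃ ∷ []))) + pathGains t₂ t₃ ts
    ≡⟨ cong (λ W → azi W + pathGains t₂ t₃ ts) (++-assoc P (sides b) _) ⟩
  azi (P ++ allSides (path b (t₁ ∷ t₂ ∷ t₃ ∷ []))) + pathGains t₂ t₃ ts
    ≡⟨ cong (_+ pathGains t₂ t₃ ts) (azi-extend P b t₁ t₂ t₃ P-below) ⟩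
  (azi₂ + windowGain t₁ t₂ t₃) + pathGains t₂ t₃ ts
    ≡⟨ ℚ.+-assoc azi₂ (windowGain t₁ t₂ t₃) (pathGains t₂ t₃ ts) ⟩
  azi₂ + pathGains t₁ t₂ (t₃ ∷ ts) ∎
  where
  open ≡-Reasoning
  b₁   = step b t₁
  azi₂ = azi (P ++ allSides (path b (t₁ ∷ t₂ ∷ [])))

turn : Dir → Link → Dir
turn d one = d
turn d two = flip d

turns : Dir → List Link → List Dir
turns d []       = []
turns d (l ∷ ls) = turn d l ∷ turns (turn d l) ls

squaresFrom-path : ∀ p d ls → p ∷ squaresFrom p d ls ≡ path p (turns d ls)
squaresFrom-path p d []         = refl
squaresFrom-path p d (one ∷ ls) = cong (p ∷_) (squaresFrom-path (step p d) d ls)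
squaresFrom-path p d (two ∷ ls) = cong (p ∷_) (squaresFrom-path (step p (flip d)) (flip d) ls)

squares-path : ∀ k ls → squares (k ∷ ls) ≡ path origin (right ∷ turn right k ∷ turns (turn right k) ls)
squares-path k ls = cong (origin ∷_) (squaresFrom-path (step origin right) right (k ∷ ls))

aziTriple : Link → ℚ
aziTriple one = ℤ.+ 1497 / 16
aziTriple two = ℤ.+ 11456 / 125

aziGain : Link → Link → ℚ
aziGain one one = ℤ.+ 2187 / 64
aziGain one two = ℤ.+ 138763 / 4000
aziGain two one = ℤ.+ 146421 / 4000
aziGain two two = ℤ.+ 944 / 27

aziGains : Link → List Link → ℚ
aziGains k []       = 0ℚ
aziGains k (l ∷ ls) = aziGain k l + aziGains l ls

windowGain-turn : ∀ t k l → windowGain t (turn t k) (turn (turn t k) l) ≡ aziGain k l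
windowGain-turn = from-yes (∀-Dir? λ t → ∀-Link? λ k → ∀-Link? λ l →
  windowGain t (turn t k) (turn (turn t k) l) ℚ.≟ aziGain k l)

pathGains-turns : ∀ t k ls → pathGains t (turn t k) (turns (turn t k) ls) ≡ aziGains k ls
pathGains-turns t k []       = refl
pathGains-turns t k (l ∷ ls) = cong₂ _+_ (windowGain-turn t k l) (pathGains-turns (turn t k) l ls)

opaque
  unfolding azi

  AZI≡azi : ∀ ls → AZI ls ≡ azi (allSides (squares ls))
  AZI≡azi ls = refl

  azi-triple : ∀ k → azi (allSides (path origin (right ∷ turn right k ∷ []))) ≡ aziTriple k
  azi-triple one = refl
  azi-triple two = refl

AZI-formula : ∀ k ls → AZI (k ∷ ls) ≡ aziTriple k + aziGains k ls
AZI-formula k ls = begin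
  AZI (k ∷ ls)
    ≡⟨ AZI≡azi (k ∷ ls) ⟩
  azi (allSides (squares (k ∷ ls)))
    ≡⟨ cong (azi ∘ allSides) (squares-path k ls) ⟩
  azi ([] ++ allSides (path origin (right ∷ t ∷ turns t ls)))
    ≡⟨ azi-path [] origin right t (turns t ls) [] ⟩
  azi (allSides (path origin (right ∷ t ∷ []))) + pathGains right t (turns t ls)
    ≡⟨ cong₂ _+_ (azi-triple k) (pathGains-turns right k ls) ⟩
  aziTriple k + aziGains k ls ∎
  where
  open ≡-Reasoning
  t = turn right k

-- Comparing chains

aziGain-one-one-≤ : ∀ k l → aziGain one one ≤ℚ aziGain k l
aziGain-one-one-≤ = from-yes (∀-Link? λ k → ∀-Link? λ l → aziGain one one ℚ.≤? aziGain k l)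

aziGains-linear-≤ : ∀ k ls → aziGains one (List.replicate (length ls) one) ≤ℚ aziGains k ls
aziGains-linear-≤ k []       = ℚ.≤-refl
aziGains-linear-≤ k (l ∷ ls) = ℚ.+-mono-≤ (aziGain-one-one-≤ k l) (aziGains-linear-≤ l ls)

linear-prefix-≤ : ∀ k l₁ l₂ l₃ →
  aziTriple one + (aziGain one one + (aziGain one one + aziGain one one))
    ≤ℚ aziTriple k + (aziGain k l₁ + (aziGain l₁ l₂ + aziGain l₂ l₃))
linear-prefix-≤ = from-yes (∀-Link? λ k → ∀-Link? λ l₁ → ∀-Link? λ l₂ → ∀-Link? λ l₃ →
  aziTriple one + (aziGain one one + (aziGain one one + aziGain one one))
    ℚ.≤? aziTriple k + (aziGain k l₁ + (aziGain l₁ l₂ + aziGain l₂ l₃)))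

linear-minimal : ∀ k l₁ l₂ l₃ ls →
  AZI (List.replicate (4 ℕ.+ length ls) one) ≤ℚ AZI (k ∷ l₁ ∷ l₂ ∷ l₃ ∷ ls)
linear-minimal k l₁ l₂ l₃ ls = begin
  AZI (List.replicate (4 ℕ.+ length ls) one)
    ≡⟨ AZI-formula one (one ∷ one ∷ one ∷ ones) ⟩
  aziTriple one + aziGains one (one ∷ one ∷ one ∷ ones)
    ≡⟨ regroup (aziTriple one) (aziGain one one) (aziGain one one) (aziGain one one) (aziGains one ones) ⟩
  (aziTriple one + (aziGain one one + (aziGain one one + aziGain one one))) + aziGains one ones
    ≤⟨ ℚ.+-mono-≤ (linear-prefix-≤ k l₁ l₂ l₃) (aziGains-linear-≤ l₃ ls) ⟩
  (aziTriple k + (aziGain k l₁ + (aziGain l₁ l₂ + aziGain l₂ l₃))) + aziGains l₃ ls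
    ≡⟨ regroup (aziTriple k) (aziGain k l₁) (aziGain l₁ l₂) (aziGain l₂ l₃) (aziGains l₃ ls) ⟨
  aziTriple k + aziGains k (l₁ ∷ l₂ ∷ l₃ ∷ ls)
    ≡⟨ AZI-formula k (l₁ ∷ l₂ ∷ l₃ ∷ ls) ⟨
  AZI (k ∷ l₁ ∷ l₂ ∷ l₃ ∷ ls) ∎
  where
  open ℚ.≤-Reasoning
  ones = List.replicate (length ls) one
  regroup : ∀ a b c d r → a + (b + (c + (d + r))) ≡ (a + (b + (c + d))) + r
  regroup = solve 5 (λ a b c d r → a :+ (b :+ (c :+ (d :+ r))) := (a :+ (b :+ (c :+ d))) :+ r) refl
    where open +-*-Solver

linear-minimal-PC : ∀ n → 6 ≤ n → (L : Vec Link (n ∸ 2)) → AZI-PC n (linear n) ≤ℚ AZI-PC n L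
linear-minimal-PC _ (s≤s (s≤s (s≤s (s≤s (s≤s (s≤s {n = m} _)))))) (k ∷ l₁ ∷ l₂ ∷ l₃ ∷ L) =
  subst (λ ls → AZI (one ∷ one ∷ one ∷ one ∷ ls) ≤ℚ AZI (k ∷ l₁ ∷ l₂ ∷ l₃ ∷ toList L))
        (trans (cong (λ m → List.replicate m one) (length-toList L)) (sym (toList-replicate m one)))
        (linear-minimal k l₁ l₂ l₃ (toList L))

zigzag-minimal-PC : ∀ n → n ≡ 3 ⊎ n ≡ 4 ⊎ n ≡ 5 → (L : Vec Link (n ∸ 2)) →
                    AZI-PC n (zigzag n) ≤ℚ AZI-PC n L
zigzag-minimal-PC _ (inj₁ refl)        = from-yes (∀-Vec? 1 λ L → AZI-PC 3 (zigzag 3) ℚ.≤? AZI-PC 3 L)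
zigzag-minimal-PC _ (inj₂ (inj₁ refl)) = from-yes (∀-Vec? 2 λ L → AZI-PC 4 (zigzag 4) ℚ.≤? AZI-PC 4 L)
zigzag-minimal-PC _ (inj₂ (inj₂ refl)) = from-yes (∀-Vec? 3 λ L → AZI-PC 5 (zigzag 5) ℚ.≤? AZI-PC 5 L)

-- The hypothesis 3 ≤ n is implied by either premise.
corollary2 : (n : ℕ) → 3 ≤ n → (L : Vec Link (n ∸ 2)) →
    (6 ≤ n → AZI-PC n (linear n) ≤ℚ AZI-PC n L) ×
    ((n ≡ 3 ⊎ n ≡ 4 ⊎ n ≡ 5) → AZI-PC n (zigzag n) ≤ℚ AZI-PC n L)
corollary2 n _ L = (λ 6≤n → linear-minimal-PC n 6≤n L) , (λ n≤5 → zigzag-minimal-PC n n≤5 L)
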